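{- Let $\mathcal A$ be a finite alphabet with $|\mathcal A|=n\ge 3$, let $r_t,r_b$ be two distinct elements of $\mathcal A$, set $\mathcal A'=\{(r_b,r_t)\}\cup(\mathcal A\setminus\{r_b,r_t\})$, and let $\sigma$ be a permutation of $\mathcal A'$. Then there is a bijection between the set of standard labeled permutations $\pi=(\pi_t,\pi_b)$ on $\mathcal A$ with $\pi_t^{ -1}(1)=r_t$ and $\pi_b^{ -1}(1)=r_b$ such that $\sigma^{out}_\pi=\sigma$, and the set of pairs $(\tau_t,\tau_b)$ of $(n-1)$-cycles on $\mathcal A'$ such that $\tau_t\tau_b^{ -1}=\sigma$. It sends $\pi$ to $\tau_t=((r_b,r_t)\ \pi_t^{ -1}(2)\ \cdots\ \pi_t^{ -1}(n-1))$, $\tau_b=((r_b,r_t)\ \pi_b^{ -1}(2)\ \cdots\ \pi_b^{ -1}(n-1))$.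
   Context: A labeled permutation on $\mathcal A$ is a pair of bijections $\pi_t,\pi_b:\mathcal A\to\{1,\dots,n\}$ (two-row array: top row $\pi_t^{ -1}(1),\dots,\pi_t^{ -1}(n)$, bottom row $\pi_b^{ -1}(1),\dots,\pi_b^{ -1}(n)$). It is standard if $\pi_t^{ -1}(1)=\pi_b^{ -1}(n)$ and $\pi_b^{ -1}(1)=\pi_t^{ -1}(n)$. Interval diagram: with symbols $a^{out},a^{in}$ ($a\in\mathcal A$) define $\tilde\sigma(a^{out})=(\pi_t^{ -1}(1))^{out}$ if $\pi_b(a)=1$ and $(\pi_b^{ -1}(\pi_b(a)-1))^{in}$ otherwise; $\tilde\sigma(a^{in})=(\pi_t^{ -1}(\pi_t(a)+1))^{out}$ if $\pi_t(a)\neq n$ and $(\pi_b^{ -1}(n))^{in}$ otherwise. Let $\mathcal A_\pi$ be the set of symbols with $(\pi_b^{ -1}(1))^{out},(\pi_t^{ -1}(1))^{out}$ identified into $L$ and $(\pi_t^{ -1}(n))^{in},(\pi_b^{ -1}(n))^{in}$ identified into $R$; $\sigma_\pi$ is the permutation of $\mathcal A_\pi$ with $\sigma_\pi(L)=\tilde\sigma((\pi_t^{ -1}(1))^{out})$, $\sigma_\pi(R)=\tilde\sigma((\pi_b^{ -1}(n))^{in})$, $\sigma_\pi=\tilde\sigma$ elsewhere. $\sigma_\pi$ exchanges out-symbols and in-symbols; $\sigma^{out}_\pi$ denotes the restriction of $\sigma_\pi^2$ to the out-symbols. For $\pi$ as in the claim, the out-symbols are identified with $\mathcal A'$ via $L\leftrightarrow(r_b,r_t)$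 and $a^{out}\leftrightarrow a$ for $a\ne r_t,r_b$. -}

module Defs where

open import Data.Nat using (ℕ; zero; suc; _+_)
open import Data.Nat.DivMod using (_mod_)
open import Data.Fin using (Fin; toℕ; fromℕ; inject₁)
open import Data.Fin.Properties using (_≟_)
open import Data.Product using (Σ; _×_; _,_)
open import Relation.Nullary using (¬_; yes; no)
open import Relation.Nullary.Decidable using (False; fromWitnessFalse)
open import Relation.Binary.PropositionalEquality using (_≡_; _≢_)
open import Function.Bundles using (_↔_; Inverse)
open import Function.Definitions using (Injective)

-- Conventions.
-- The alphabet 𝒜 of size n is Fin n; the positions {1,…,n} are also
-- Fin n, 0-indexed: position 1 is `zero`, position n is `fromℕ k`
-- (where n = suc k).

sucMod : ∀ {k} → Fin (suc k) → Fin (suc k)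
sucMod {k} i = suc (toℕ i) mod suc k

predMod : ∀ {k} → Fin (suc k) → Fin (suc k)
predMod {k} i = (toℕ i + k) mod suc k

-- Labeled permutations: π_t, π_b : 𝒜 → {1..n} bijections.
-- `Inverse.to` is π_t (resp. π_b), `Inverse.from` is π_t⁻¹ (resp. π_b⁻¹).

record LabeledPerm (n : ℕ) : Set where
  field
    πt : Fin n ↔ Fin n
    πb : Fin n ↔ Fin n

module _ {k : ℕ} (π : LabeledPerm (suc k)) where
  open LabeledPerm π
  open Inverse

  first last : Fin (suc k)
  first = Data.Fin.zero
  last  = fromℕ k

  Standard : Set
  Standard = (from πt first ≡ from πb last) × (from πb first ≡ from πt last)

data Sym (A : Set) : Set where
  out : A → Sym A
  inn : A → Sym A

module _ {k : ℕ} (π : LabeledPerm (suc k)) where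
  open LabeledPerm π
  open Inverse

  private
    first' last' : Fin (suc k)
    first' = Data.Fin.zero
    last'  = fromℕ k

  σ̃ : Sym (Fin (suc k)) → Sym (Fin (suc k))
  σ̃ (out a) with to πb a ≟ first'
  ... | yes _ = out (from πt first')
  ... | no  _ = inn (from πb (predMod (to πb a)))
  σ̃ (inn a) with to πt a ≟ last'
  ... | yes _ = inn (from πb last')
  ... | no  _ = out (from πt (sucMod (to πt a)))

  -- 𝒜_π is represented by canonical representatives of Sym:
  -- L is represented by (π_t⁻¹(1))^out  (identified with (π_b⁻¹(1))^out),
  -- R is represented by (π_b⁻¹(n))^in   (identified with (π_t⁻¹(n))^in).
  canon : Sym (Fin (suc k)) → Sym (Fin (suc k))
  canon (out a) with a ≟ from πb first'
  ... | yes _ = out (from πt first')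
  ... | no  _ = out a
  canon (inn a) with a ≟ from πt last'
  ... | yes _ = inn (from πb last')
  ... | no  _ = inn a

  -- σ_π on representatives: σ_π(L) = [σ̃((π_t⁻¹(1))^out)],
  -- σ_π(R) = [σ̃((π_b⁻¹(n))^in)], σ_π = [σ̃] elsewhere.
  σπ : Sym (Fin (suc k)) → Sym (Fin (suc k))
  σπ x = canon (σ̃ x)

data A' {n : ℕ} (rt rb : Fin n) : Set where
  pair : A' rt rb
  old  : (a : Fin n) → False (a ≟ rt) → False (a ≟ rb) → A' rt rb

toA' : ∀ {n} {rt rb : Fin n} → Fin n → A' rt rb
toA' {rt = rt} {rb} a with a ≟ rt
... | yes _ = pair
... | no ¬p with a ≟ rb
...   | yes _ = pair
...   | no ¬q = old a (fromWitnessFalse ¬p) (fromWitnessFalse ¬q)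

-- identification of out-symbols with 𝒜': L ↔ (r_b,r_t), a^out ↔ a.
-- (L is represented by (π_t⁻¹(1))^out = r_t^out.)
A'→Sym : ∀ {n} {rt rb : Fin n} → A' rt rb → Sym (Fin n)
A'→Sym {rt = rt} pair = out rt
A'→Sym (old a _ _) = out a

-- inverse identification (in-symbols never occur; sent to a junk value)
Sym→A' : ∀ {n} {rt rb : Fin n} → Sym (Fin n) → A' rt rb
Sym→A' (out a) = toA' a
Sym→A' (inn a) = pair

-- σ^out_π : restriction of σ_π² to out-symbols, seen as a map 𝒜' → 𝒜'
σout : ∀ {k} (π : LabeledPerm (suc k)) (rt rb : Fin (suc k)) →
       A' rt rb → A' rt rb
σout π rt rb x = Sym→A' (σπ π (σπ π (A'→Sym x)))

Perm : Set → Set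
Perm X = X ↔ X

CycleNotation : ∀ {X : Set} {j : ℕ} → (X → X) → (Fin (suc j) → X) → Set
CycleNotation {X} f c =
  (∀ i → f (c i) ≡ c (sucMod i)) × (∀ x → (∀ i → c i ≢ x) → f x ≡ x)

IsCycle : ∀ {X : Set} (j : ℕ) → Perm X → Set
IsCycle {X} j τ =
  Σ (Fin (suc j) → X) λ c → Injective _≡_ _≡_ c × CycleNotation (Inverse.to τ) c

-- The two sets of Proposition 4.1 and the assignment between them.
-- Here |𝒜| = n = suc (suc (suc m)) ≥ 3 and |𝒜'| = n - 1 = suc (suc m).

module Prop41 (m : ℕ) (rt rb : Fin (suc (suc (suc m)))) (σ : Perm (A' rt rb)) where

  Src : LabeledPerm (suc (suc (suc m))) → Set
  Src π = Standard π
        × (Inverse.from (LabeledPerm.πt π) Data.Fin.zero ≡ rt)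
        × (Inverse.from (LabeledPerm.πb π) Data.Fin.zero ≡ rb)
        × (∀ x → σout π rt rb x ≡ Inverse.to σ x)

  -- pairs of (n-1)-cycles (τ_t, τ_b) on 𝒜' with τ_t τ_b⁻¹ = σ
  -- (composition right-to-left: (τ_t τ_b⁻¹)(x) = τ_t(τ_b⁻¹(x)))
  Tgt : Perm (A' rt rb) → Perm (A' rt rb) → Set
  Tgt τt τb = IsCycle (suc m) τt × IsCycle (suc m) τb
            × (∀ x → Inverse.to τt (Inverse.from τb x) ≡ Inverse.to σ x)

  -- the cycle entries ((r_b,r_t) π⁻¹(2) ⋯ π⁻¹(n-1)); entry i (0-indexed)
  -- is the image in 𝒜' of the letter at position i+1, and the letter at
  -- position 1 is r_t (resp. r_b), which is sent to (r_b,r_t).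
  ct cb : LabeledPerm (suc (suc (suc m))) → Fin (suc (suc m)) → A' rt rb
  ct π i = toA' (Inverse.from (LabeledPerm.πt π) (inject₁ i))
  cb π i = toA' (Inverse.from (LabeledPerm.πb π) (inject₁ i))

  Sends : LabeledPerm (suc (suc (suc m))) → Perm (A' rt rb) → Perm (A' rt rb) → Set
  Sends π τt τb = CycleNotation (Inverse.to τt) (ct π)
                × CycleNotation (Inverse.to τb) (cb π)

module Submission where

-- Rows and (j+1)-cycles correspond
--    bijectively, and the cycle moves col(y) to col(p⁻¹(p(y)+1)).
--  * The alphabet 𝒜' is such a collapse for both rows of π.
--  * Unfolding σ_π twice on an out-symbol x gives τ_t(τ_b⁻¹(x)): both go
--    one letter back in the bottom row, then one letter on in the top row
--    (σout-cycles).

open import Defs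
open import Data.Nat using (ℕ; zero; suc; _+_; _%_; s≤s; NonZero)
open import Data.Nat.Properties using (+-suc; ≤-refl; m<n⇒m<1+n; 1+n≰n)
open import Data.Nat.DivMod using (_mod_; m<n⇒m%n≡m; n%n≡0; [m+n]%n≡m%n)
open import Data.Fin using (Fin; zero; suc; toℕ; fromℕ; inject₁; punchOut; punchIn)
open import Data.Fin.Properties
  using (_≟_; any?; toℕ-injective; toℕ-fromℕ<; toℕ-fromℕ; toℕ-inject₁; toℕ<n;
         fromℕ≢inject₁; inject₁-injective; punchOut-injective; injective⇒≤)
open import Data.Fin.Relation.Unary.Top using (View; view; ‵fromℕ; ‵inject₁)
open import Data.Fin.Induction using (<-weakInduction)
open import Data.Vec.Functional using (insertAt)
open import Data.Vec.Functional.Properties using (insertAt-lookup; insertAt-punchIn)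
open import Data.Bool.Properties using (T-irrelevant)
open import Data.Product using (Σ; _×_; _,_; proj₁; proj₂)
open import Data.Empty using (⊥-elim)
open import Relation.Nullary using (Dec; yes; no)
open import Relation.Nullary.Decidable using (False; toWitnessFalse)
open import Relation.Binary.PropositionalEquality
open import Function using (_∘_)
open import Function.Bundles using (Inverse; _↔_; mk↔ₛ′)
open import Function.Definitions using (Injective)

open Inverse

from-injective : ∀ {A B : Set} (p : A ↔ B) {x y : B} → from p x ≡ from p y → x ≡ y
from-injective p {x} {y} e =
  trans (sym (strictlyInverseˡ p x)) (trans (cong (to p) e) (strictlyInverseˡ p y))

to-unique : ∀ {A B : Set} (p p' : A ↔ B) → (∀ y → from p y ≡ from p' y) →
            ∀ x → to p x ≡ to p' x
to-unique p p' same x = from-injective p' (begin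
  from p' (to p x) ≡⟨ sym (same (to p x)) ⟩
  from p (to p x)  ≡⟨ strictlyInverseʳ p x ⟩
  x                ≡⟨ sym (strictlyInverseʳ p' x) ⟩
  from p' (to p' x) ∎)
  where open ≡-Reasoning

toℕ-mod : ∀ n d .{{_ : NonZero d}} → toℕ (n mod d) ≡ n % d
toℕ-mod n d = toℕ-fromℕ< _

sucMod-inject₁ : ∀ {k} (i : Fin k) → sucMod (inject₁ i) ≡ suc i
sucMod-inject₁ {k} i = toℕ-injective (begin
  toℕ (sucMod (inject₁ i))      ≡⟨ toℕ-mod (suc (toℕ (inject₁ i))) (suc k) ⟩
  suc (toℕ (inject₁ i)) % suc k ≡⟨ cong (λ t → suc t % suc k) (toℕ-inject₁ i) ⟩
  suc (toℕ i) % suc k           ≡⟨ m<n⇒m%n≡m (s≤s (toℕ<n i)) ⟩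
  suc (toℕ i)                   ∎)
  where open ≡-Reasoning

sucMod-fromℕ : ∀ k → sucMod (fromℕ k) ≡ zero
sucMod-fromℕ k = toℕ-injective (begin
  toℕ (sucMod (fromℕ k))      ≡⟨ toℕ-mod (suc (toℕ (fromℕ k))) (suc k) ⟩
  suc (toℕ (fromℕ k)) % suc k ≡⟨ cong (λ t → suc t % suc k) (toℕ-fromℕ k) ⟩
  suc k % suc k               ≡⟨ n%n≡0 (suc k) ⟩
  0                           ∎)
  where open ≡-Reasoning

predMod-zero : ∀ k → predMod {k} zero ≡ fromℕ k
predMod-zero k = toℕ-injective (begin
  toℕ (predMod {k} zero) ≡⟨ toℕ-mod k (suc k) ⟩
  k % suc k              ≡⟨ m<n⇒m%n≡m (s≤s ≤-refl) ⟩
  k                      ≡⟨ sym (toℕ-fromℕ k) ⟩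
  toℕ (fromℕ k)          ∎)
  where open ≡-Reasoning

predMod-suc : ∀ {k} (i : Fin k) → predMod (suc i) ≡ inject₁ i
predMod-suc {k} i = toℕ-injective (begin
  toℕ (predMod (suc i))     ≡⟨ toℕ-mod (suc (toℕ i) + k) (suc k) ⟩
  (suc (toℕ i) + k) % suc k ≡⟨ cong (_% suc k) (sym (+-suc (toℕ i) k)) ⟩
  (toℕ i + suc k) % suc k   ≡⟨ [m+n]%n≡m%n (toℕ i) (suc k) ⟩
  toℕ i % suc k             ≡⟨ m<n⇒m%n≡m (m<n⇒m<1+n (toℕ<n i)) ⟩
  toℕ i                     ≡⟨ sym (toℕ-inject₁ i) ⟩
  toℕ (inject₁ i)           ∎)
  where open ≡-Reasoning

sucMod-predMod : ∀ {k} (i : Fin (suc k)) → sucMod (predMod i) ≡ i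
sucMod-predMod {k} zero    = trans (cong sucMod (predMod-zero k)) (sucMod-fromℕ k)
sucMod-predMod     (suc i) = trans (cong sucMod (predMod-suc i)) (sucMod-inject₁ i)

predMod-sucMod : ∀ {k} (i : Fin (suc k)) → predMod (sucMod i) ≡ i
predMod-sucMod i = go (view i)
  where
  go : ∀ {k} {i : Fin (suc k)} → View i → predMod (sucMod i) ≡ i
  go {k} ‵fromℕ       = trans (cong predMod (sucMod-fromℕ k)) (predMod-zero k)
  go     (‵inject₁ i) = trans (cong predMod (sucMod-inject₁ i)) (predMod-suc i)

sucMod-injective : ∀ {k} → Injective _≡_ _≡_ (sucMod {k})
sucMod-injective {x = i} {i'} e =
  trans (sym (predMod-sucMod i)) (trans (cong predMod e) (predMod-sucMod i'))

injective⇒surjective : ∀ {n} (f : Fin n → Fin n) → Injective _≡_ _≡_ f →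
                       ∀ y → Σ (Fin n) λ i → f i ≡ y
injective⇒surjective {zero}  f f-inj ()
injective⇒surjective {suc n} f f-inj y with any? (λ i → f i ≟ y)
... | yes hit = hit
... | no miss = ⊥-elim (1+n≰n (injective⇒≤ {f = squeeze} squeeze-injective))
  where
  -- if y is missed, punching it out gives an injection Fin (suc n) → Fin n
  missed : ∀ i → y ≢ f i
  missed i e = miss (i , sym e)
  squeeze : Fin (suc n) → Fin n
  squeeze i = punchOut (missed i)
  squeeze-injective : Injective _≡_ _≡_ squeeze
  squeeze-injective e = f-inj (punchOut-injective (missed _) (missed _) e)

invertInjective : ∀ {n} (f : Fin n → Fin n) → Injective _≡_ _≡_ f → Fin n ↔ Fin n
invertInjective {n} f f-inj = mk↔ₛ′ preimage f
  (λ y → f-inj (proj₂ (injective⇒surjective f f-inj (f y))))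
  (λ y → proj₂ (injective⇒surjective f f-inj y))
  where
  preimage : Fin n → Fin n
  preimage y = proj₁ (injective⇒surjective f f-inj y)

module _ {X : Set} {j : ℕ} where

  cycle-step : ∀ {f : X → X} {c : Fin (suc j) → X} → CycleNotation f c →
               ∀ (i : Fin j) → c (suc i) ≡ f (c (inject₁ i))
  cycle-step {f} {c} (next , _) i =
    trans (cong c (sym (sucMod-inject₁ i))) (sym (next (inject₁ i)))

  cycle-determines : ∀ {f g : X → X} {c : Fin (suc j) → X} →
                     (∀ x → Σ (Fin (suc j)) λ i → c i ≡ x) →
                     CycleNotation f c → CycleNotation g c → ∀ x → f x ≡ g x
  cycle-determines c-surj (next , _) (next' , _) x with c-surj x
  ... | i , refl = trans (next i) (sym (next' i))

  cycle-rigid : ∀ {f : X → X} {c c' : Fin (suc j) → X} →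
                CycleNotation f c → CycleNotation f c' → c zero ≡ c' zero →
                ∀ i → c i ≡ c' i
  cycle-rigid {f} {c} {c'} cn cn' start =
    <-weakInduction (λ i → c i ≡ c' i) start λ i same → begin
      c (suc i)            ≡⟨ cycle-step cn i ⟩
      f (c (inject₁ i))    ≡⟨ cong f same ⟩
      f (c' (inject₁ i))   ≡⟨ sym (cycle-step cn' i) ⟩
      c' (suc i)           ∎
    where open ≡-Reasoning

  cycle-cong : ∀ {f : X → X} {c c' : Fin (suc j) → X} →
               (∀ i → c i ≡ c' i) → CycleNotation f c → CycleNotation f c'
  cycle-cong {f} same (next , fixed) =
    (λ i → trans (cong f (sym (same i))) (trans (next i) (same (sucMod i)))) ,
    (λ x missed → fixed x (λ i e → missed i (trans (sym (same i)) e)))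

  cycle-rotate : ∀ {f : X → X} {c : Fin (suc j) → X} →
                 Injective _≡_ _≡_ c → CycleNotation f c →
                 Injective _≡_ _≡_ (c ∘ sucMod) × CycleNotation f (c ∘ sucMod)
  cycle-rotate {c = c} c-inj (next , fixed) =
    sucMod-injective ∘ c-inj ,
    (λ i → next (sucMod i)) ,
    (λ x missed → fixed x (λ i e → missed (predMod i) (trans (cong c (sucMod-predMod i)) e)))

  cycle-startAt : ∀ {f : X → X} {c : Fin (suc j) → X} →
                  Injective _≡_ _≡_ c → CycleNotation f c → ∀ i →
                  Σ (Fin (suc j) → X) λ d →
                    Injective _≡_ _≡_ d × CycleNotation f d × d zero ≡ c i
  cycle-startAt {f} {c} c-inj cn =
    <-weakInduction StartsAt (c , c-inj , cn , refl) λ i (d , d-inj , dn , d₀) →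
      let d-inj' , dn' = cycle-rotate d-inj dn in
      d ∘ sucMod , d-inj' , dn' , (begin
        d (sucMod zero)   ≡⟨ sym (proj₁ dn zero) ⟩
        f (d zero)        ≡⟨ cong f d₀ ⟩
        f (c (inject₁ i)) ≡⟨ sym (cycle-step cn i) ⟩
        c (suc i)         ∎)
    where
    open ≡-Reasoning
    StartsAt : Fin (suc j) → Set
    StartsAt i = Σ (Fin (suc j) → X) λ d →
                   Injective _≡_ _≡_ d × CycleNotation f d × d zero ≡ c i

  module CycleOf (e : Fin (suc j) → X) (e-inj : Injective _≡_ _≡_ e)
                 (e-surj : ∀ x → Σ (Fin (suc j)) λ i → e i ≡ x) where

    position : X → Fin (suc j)
    position x = proj₁ (e-surj x)

    e-position : ∀ x → e (position x) ≡ x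
    e-position x = proj₂ (e-surj x)

    position-e : ∀ i → position (e i) ≡ i
    position-e i = e-inj (e-position (e i))

    cycle : Perm X
    cycle = mk↔ₛ′ (e ∘ sucMod ∘ position) (e ∘ predMod ∘ position)
      (λ x → begin
        e (sucMod (position (e (predMod (position x))))) ≡⟨ cong (e ∘ sucMod) (position-e _) ⟩
        e (sucMod (predMod (position x)))                ≡⟨ cong e (sucMod-predMod _) ⟩
        e (position x)                                   ≡⟨ e-position x ⟩
        x                                                ∎)
      (λ x → begin
        e (predMod (position (e (sucMod (position x))))) ≡⟨ cong (e ∘ predMod) (position-e _) ⟩
        e (predMod (sucMod (position x)))                ≡⟨ cong e (predMod-sucMod _) ⟩
        e (position x)                                   ≡⟨ e-position x ⟩
        x                                                ∎)
      where open ≡-Reasoning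

    cycle-notation : CycleNotation (to cycle) e
    cycle-notation = (λ i → cong (e ∘ sucMod) (position-e i)) ,
                     (λ x missed → ⊥-elim (missed (position x) (e-position x)))

    cycle-isCycle : IsCycle j cycle
    cycle-isCycle = e , e-inj , cycle-notation

-- Collapsing two letters r₀ ≠ r₁ of Fin n into one symbol of X:
-- col identifies r₁ with r₀ and is otherwise a bijection, with inverse
-- lift (which never returns r₁).

record Collapse (X : Set) {n : ℕ} (r₀ r₁ : Fin n) : Set where
  field
    col      : Fin n → X
    lift     : X → Fin n
    col-lift : ∀ x → col (lift x) ≡ x
    lift-col : ∀ a → a ≢ r₁ → lift (col a) ≡ a
    lift-≢   : ∀ x → lift x ≢ r₁
    col-r₁   : col r₁ ≡ col r₀
    r₀≢r₁    : r₀ ≢ r₁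

  lift-injective : Injective _≡_ _≡_ lift
  lift-injective {x} {y} e = trans (sym (col-lift x)) (trans (cong col e) (col-lift y))

-- A row is a bijection p of the positions Fin (j+2) whose first
-- letter is r₀ and whose last letter is r₁; reading it left to right
-- without the last letter, through col, enumerates X.

module Rows {X : Set} {j : ℕ} {r₀ r₁ : Fin (suc (suc j))} (C : Collapse X r₀ r₁) where
  open Collapse C

  Positions : Set
  Positions = Fin (suc (suc j))

  final : Positions
  final = fromℕ (suc j)

  record Row (p : Positions ↔ Positions) : Set where
    field
      first-letter : from p zero ≡ r₀
      last-letter  : from p final ≡ r₁

  open Row public

  -- X has j+1 elements: lift, with r₁ punched out, embeds it in Fin (j+1).
  r₁≢lift : ∀ x → r₁ ≢ lift x
  r₁≢lift x e = lift-≢ x (sym e)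

  code : X → Fin (suc j)
  code x = punchOut (r₁≢lift x)

  code-injective : Injective _≡_ _≡_ code
  code-injective {x} {y} e = lift-injective (punchOut-injective (r₁≢lift x) (r₁≢lift y) e)

  enumeration-surjective : (c : Fin (suc j) → X) → Injective _≡_ _≡_ c →
                           ∀ x → Σ (Fin (suc j)) λ i → c i ≡ x
  enumeration-surjective c c-inj x =
    let i , same-code = injective⇒surjective (code ∘ c) (c-inj ∘ code-injective) (code x)
    in i , code-injective same-code

  enum : Positions ↔ Positions → Fin (suc j) → X
  enum p i = col (from p (inject₁ i))

  module _ {p : Positions ↔ Positions} (row : Row p) where

    not-last : ∀ i → from p (inject₁ i) ≢ r₁
    not-last i e = fromℕ≢inject₁ (sym (from-injective p (trans e (sym (last-letter row)))))

    enum-injective : Injective _≡_ _≡_ (enum p)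
    enum-injective {i} {i'} e = inject₁-injective (from-injective p (begin
      from p (inject₁ i)              ≡⟨ sym (lift-col _ (not-last i)) ⟩
      lift (col (from p (inject₁ i)))  ≡⟨ cong lift e ⟩
      lift (col (from p (inject₁ i'))) ≡⟨ lift-col _ (not-last i') ⟩
      from p (inject₁ i')             ∎))
      where open ≡-Reasoning

    enum-surjective : ∀ x → Σ (Fin (suc j)) λ i → enum p i ≡ x
    enum-surjective = enumeration-surjective (enum p) enum-injective

    -- The successor of entry i is col of the letter after position i; at
    -- the end of the row this uses that r₁ and r₀ collapse together.
    enum-sucMod : ∀ i → enum p (sucMod i) ≡ col (from p (sucMod (inject₁ i)))
    enum-sucMod i = go (view i)
      where
      go : ∀ {i} → View i → enum p (sucMod i) ≡ col (from p (sucMod (inject₁ i)))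
      go ‵fromℕ = begin
        enum p (sucMod (fromℕ j))                 ≡⟨ cong (enum p) (sucMod-fromℕ j) ⟩
        col (from p zero)                         ≡⟨ cong col (first-letter row) ⟩
        col r₀                                    ≡⟨ sym col-r₁ ⟩
        col r₁                                    ≡⟨ cong col (sym (last-letter row)) ⟩
        col (from p final)                         ≡⟨ cong (col ∘ from p) (sym (sucMod-inject₁ (fromℕ j))) ⟩
        col (from p (sucMod (inject₁ (fromℕ j)))) ∎
        where open ≡-Reasoning
      go (‵inject₁ i) = trans (cong (enum p) (sucMod-inject₁ i))
                              (cong (col ∘ from p) (sym (sucMod-inject₁ (inject₁ i))))

    shift : ∀ {f : X → X} → CycleNotation f (enum p) → ∀ {y} → y ≢ r₁ →
            f (col y) ≡ col (from p (sucMod (to p y)))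
    shift {f} (next , _) {y} y≢r₁ =
      subst (λ z → f (col z) ≡ col (from p (sucMod (to p y))))
            (strictlyInverseʳ p y)
            (go (view (to p y)) (λ e → y≢r₁ (trans (sym (strictlyInverseʳ p y)) e)))
      where
      go : ∀ {q} → View q → from p q ≢ r₁ → f (col (from p q)) ≡ col (from p (sucMod q))
      go ‵fromℕ       q≢r₁ = ⊥-elim (q≢r₁ (last-letter row))
      go (‵inject₁ i) _    = trans (next i) (enum-sucMod i)

    unshift : (τ : Perm X) → CycleNotation (to τ) (enum p) → ∀ {y} → y ≢ r₀ →
              from τ (col y) ≡ col (from p (predMod (to p y)))
    unshift τ cn {y} y≢r₀ = begin
      from τ (col y)                           ≡⟨ cong (from τ) (sym forward) ⟩
      from τ (to τ (col z))                    ≡⟨ strictlyInverseʳ τ (col z) ⟩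
      col z                                    ∎
      where
      open ≡-Reasoning
      z = from p (predMod (to p y))
      z≢r₁ : z ≢ r₁
      z≢r₁ e = y≢r₀ (begin
        y                                  ≡⟨ sym (strictlyInverseʳ p y) ⟩
        from p (to p y)                    ≡⟨ cong (from p) (sym (sucMod-predMod (to p y))) ⟩
        from p (sucMod (predMod (to p y))) ≡⟨ cong (from p ∘ sucMod) (from-injective p (trans e (sym (last-letter row)))) ⟩
        from p (sucMod final)               ≡⟨ cong (from p) (sucMod-fromℕ (suc j)) ⟩
        from p zero                        ≡⟨ first-letter row ⟩
        r₀                                 ∎)
      forward : to τ (col z) ≡ col y
      forward = begin
        to τ (col z)                                ≡⟨ shift cn z≢r₁ ⟩
        col (from p (sucMod (to p z)))              ≡⟨ cong (col ∘ from p ∘ sucMod) (strictlyInverseˡ p _) ⟩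
        col (from p (sucMod (predMod (to p y)))) ≡⟨ cong (col ∘ from p) (sucMod-predMod (to p y)) ⟩
        col (from p (to p y))                      ≡⟨ cong col (strictlyInverseʳ p y) ⟩
        col y                                      ∎

    open CycleOf (enum p) enum-injective enum-surjective public
      using (cycle; cycle-notation; cycle-isCycle)

  row-rigid : ∀ {p p'} → Row p → Row p' → ∀ {f : X → X} →
              CycleNotation f (enum p) → CycleNotation f (enum p') →
              ∀ a → to p a ≡ to p' a
  row-rigid {p} {p'} row row' cn cn' = to-unique p p' (λ q → go (view q))
    where
    same-enum : ∀ i → enum p i ≡ enum p' i
    same-enum = cycle-rigid cn cn' (trans (cong col (first-letter row)) (sym (cong col (first-letter row'))))
    go : ∀ {q} → View q → from p q ≡ from p' q
    go ‵fromℕ       = trans (last-letter row) (sym (last-letter row'))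
    go (‵inject₁ i) = begin
      from p (inject₁ i)  ≡⟨ sym (lift-col _ (not-last row i)) ⟩
      lift (enum p i)     ≡⟨ cong lift (same-enum i) ⟩
      lift (enum p' i)    ≡⟨ lift-col _ (not-last row' i) ⟩
      from p' (inject₁ i) ∎
      where open ≡-Reasoning

  -- Every injective enumeration d of X starting at col r₀ is read off a
  -- row: its inverse lists the letters lift (d i) and then r₁.
  row-of-enumeration : (d : Fin (suc j) → X) → Injective _≡_ _≡_ d → d zero ≡ col r₀ →
                       Σ (Positions ↔ Positions) λ p → Row p × (∀ i → enum p i ≡ d i)
  row-of-enumeration d d-inj d₀ =
    p , record { first-letter = row₀ ; last-letter = letters-final } , enum-p
    where
    open ≡-Reasoning

    letters : Positions → Positions
    letters = insertAt (lift ∘ d) final r₁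

    punchIn-last : ∀ {k} (i : Fin k) → punchIn (fromℕ k) i ≡ inject₁ i
    punchIn-last zero    = refl
    punchIn-last (suc i) = cong suc (punchIn-last i)

    letter-at : ∀ i → letters (inject₁ i) ≡ lift (d i)
    letter-at i = trans (cong letters (sym (punchIn-last i))) (insertAt-punchIn (lift ∘ d) final r₁ i)

    letters-final : letters final ≡ r₁
    letters-final = insertAt-lookup (lift ∘ d) final r₁

    letters-injective : Injective _≡_ _≡_ letters
    letters-injective {q} {q'} = go (view q) (view q')
      where
      go : ∀ {q q'} → View q → View q' → letters q ≡ letters q' → q ≡ q'
      go ‵fromℕ       ‵fromℕ        _ = refl
      go ‵fromℕ       (‵inject₁ i') e = ⊥-elim (lift-≢ (d i') (trans (sym (letter-at i')) (trans (sym e) letters-final)))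
      go (‵inject₁ i) ‵fromℕ        e = ⊥-elim (lift-≢ (d i) (trans (sym (letter-at i)) (trans e letters-final)))
      go (‵inject₁ i) (‵inject₁ i') e =
        cong inject₁ (d-inj (lift-injective (trans (sym (letter-at i)) (trans e (letter-at i')))))

    p : Positions ↔ Positions
    p = invertInjective letters letters-injective

    row₀ : from p zero ≡ r₀
    row₀ = begin
      letters (inject₁ zero) ≡⟨ letter-at zero ⟩
      lift (d zero)          ≡⟨ cong lift d₀ ⟩
      lift (col r₀)          ≡⟨ lift-col r₀ r₀≢r₁ ⟩
      r₀                     ∎

    enum-p : ∀ i → enum p i ≡ d i
    enum-p i = trans (cong col (letter-at i)) (col-lift (d i))

  -- Every (j+1)-cycle is written by a row: start its notation at col r₀
  -- and read it off a row.
  row-of-cycle : (τ : Perm X) → IsCycle j τ →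
                 Σ (Positions ↔ Positions) λ p → Row p × CycleNotation (to τ) (enum p)
  row-of-cycle τ (c , c-inj , cn) with enumeration-surjective c c-inj (col r₀)
  ... | i₀ , c-i₀ with cycle-startAt c-inj cn i₀
  ... | d , d-inj , dn , d₀ with row-of-enumeration d d-inj (trans d₀ c-i₀)
  ... | p , row , enum-p = p , row , cycle-cong (λ i → sym (enum-p i)) dn

-- The alphabet 𝒜' collapses r_t and r_b into the letter (r_b,r_t); this
-- is a collapse both for (r₀,r₁) = (r_t,r_b) and for (r₀,r₁) = (r_b,r_t).

module Alphabet {n : ℕ} {rt rb : Fin n} (rt≢rb : rt ≢ rb) where

  letter : Fin n → A' rt rb → Fin n
  letter r pair        = r
  letter r (old a _ _) = a

  toA'-rt : toA' {rt = rt} {rb} rt ≡ pair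
  toA'-rt with rt ≟ rt
  ... | yes _   = refl
  ... | no rt≢rt = ⊥-elim (rt≢rt refl)

  toA'-rb : toA' {rt = rt} {rb} rb ≡ pair
  toA'-rb with rb ≟ rt
  ... | yes _ = refl
  ... | no _ with rb ≟ rb
  ...   | yes _   = refl
  ...   | no rb≢rb = ⊥-elim (rb≢rb refl)

  letter-toA' : ∀ r {a} → a ≢ rt → a ≢ rb → letter r (toA' a) ≡ a
  letter-toA' r {a} a≢rt a≢rb with a ≟ rt
  ... | yes a≡rt = ⊥-elim (a≢rt a≡rt)
  ... | no _ with a ≟ rb
  ...   | yes a≡rb = ⊥-elim (a≢rb a≡rb)
  ...   | no _     = refl

  -- The same, as an equation in 𝒜' (whose membership proofs are unique).
  toA'-old : ∀ a (p : False (a ≟ rt)) (q : False (a ≟ rb)) → toA' a ≡ old a p q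
  toA'-old a p q = go (toA' a) (letter-toA' rt (toWitnessFalse p) (toWitnessFalse q))
    where
    go : ∀ x → letter rt x ≡ a → x ≡ old a p q
    go pair          rt≡a = ⊥-elim (toWitnessFalse p (sym rt≡a))
    go (old _ p' q') refl = cong₂ (old a) (T-irrelevant p' p) (T-irrelevant q' q)

  toA'-letter : ∀ r → toA' r ≡ pair → ∀ x → toA' (letter r x) ≡ x
  toA'-letter r r↦pair pair        = r↦pair
  toA'-letter r r↦pair (old a p q) = toA'-old a p q

  topCollapse : Collapse (A' rt rb) rt rb
  topCollapse = record
    { col      = toA'
    ; lift     = letter rt
    ; col-lift = toA'-letter rt toA'-rt
    ; lift-col = lift-col
    ; lift-≢   = lift-≢
    ; col-r₁   = trans toA'-rb (sym toA'-rt)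
    ; r₀≢r₁    = rt≢rb
    }
    where
    lift-col : ∀ a → a ≢ rb → letter rt (toA' a) ≡ a
    lift-col a a≢rb = go (a ≟ rt)
      where
      go : Dec (a ≡ rt) → letter rt (toA' a) ≡ a
      go (yes refl) = cong (letter rt) toA'-rt
      go (no a≢rt)  = letter-toA' rt a≢rt a≢rb
    lift-≢ : ∀ x → letter rt x ≢ rb
    lift-≢ pair        = rt≢rb
    lift-≢ (old a _ q) = toWitnessFalse q

  bottomCollapse : Collapse (A' rt rb) rb rt
  bottomCollapse = record
    { col      = toA'
    ; lift     = letter rb
    ; col-lift = toA'-letter rb toA'-rb
    ; lift-col = lift-col
    ; lift-≢   = lift-≢
    ; col-r₁   = trans toA'-rt (sym toA'-rb)
    ; r₀≢r₁    = rt≢rb ∘ sym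
    }
    where
    lift-col : ∀ a → a ≢ rt → letter rb (toA' a) ≡ a
    lift-col a a≢rt = go (a ≟ rb)
      where
      go : Dec (a ≡ rb) → letter rb (toA' a) ≡ a
      go (yes refl) = cong (letter rb) toA'-rb
      go (no a≢rb)  = letter-toA' rb a≢rt a≢rb
    lift-≢ : ∀ x → letter rb x ≢ rt
    lift-≢ pair        = rt≢rb ∘ sym
    lift-≢ (old a p _) = toWitnessFalse p

  A'→Sym-letter : ∀ x → A'→Sym x ≡ out (letter rt x)
  A'→Sym-letter pair        = refl
  A'→Sym-letter (old _ _ _) = refl

module IntervalDiagram {k : ℕ} (π : LabeledPerm (suc k)) where
  open LabeledPerm π

  σ̃-out : ∀ a → to πb a ≢ zero → σ̃ π (out a) ≡ inn (from πb (predMod (to πb a)))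
  σ̃-out a a-not-first with to πb a ≟ zero
  ... | yes a-first = ⊥-elim (a-not-first a-first)
  ... | no _        = refl

  σ̃-inn : ∀ a → to πt a ≢ fromℕ k → σ̃ π (inn a) ≡ out (from πt (sucMod (to πt a)))
  σ̃-inn a a-not-last with to πt a ≟ fromℕ k
  ... | yes a-last = ⊥-elim (a-not-last a-last)
  ... | no _       = refl

at-position : ∀ {A B : Set} (p : A ↔ B) {a q} → to p a ≡ q → a ≡ from p q
at-position p {a} e = trans (sym (strictlyInverseʳ p a)) (cong (from p) e)

module Proposition (m : ℕ) {rt rb : Fin (suc (suc (suc m)))} (rt≢rb : rt ≢ rb) where
  open Alphabet rt≢rb
  module Top    = Rows topCollapse
  module Bottom = Rows bottomCollapse
  open Rows public using (first-letter; last-letter)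

  N : ℕ
  N = suc (suc (suc m))

  standard⇒rows : (π : LabeledPerm N) → Standard π →
                  from (LabeledPerm.πt π) zero ≡ rt → from (LabeledPerm.πb π) zero ≡ rb →
                  Top.Row (LabeledPerm.πt π) × Bottom.Row (LabeledPerm.πb π)
  standard⇒rows π (top₀≡bottomₙ , bottom₀≡topₙ) top₀ bottom₀ =
    record { first-letter = top₀    ; last-letter = trans (sym bottom₀≡topₙ) bottom₀ } ,
    record { first-letter = bottom₀ ; last-letter = trans (sym top₀≡bottomₙ) top₀ }

  rows⇒standard : ∀ {pt pb} → Top.Row pt → Bottom.Row pb →
                  Standard (record { πt = pt ; πb = pb })
  rows⇒standard rowt rowb = trans (first-letter rowt) (sym (last-letter rowb)) ,
                            trans (first-letter rowb) (sym (last-letter rowt))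

  module _ (π : LabeledPerm N) (rowt : Top.Row (LabeledPerm.πt π))
           (rowb : Bottom.Row (LabeledPerm.πb π)) where
    open LabeledPerm π
    open IntervalDiagram π

    canon-inn : ∀ b → Σ (Fin N) λ c → canon π (inn b) ≡ inn c × c ≢ rb × toA' {rt = rt} {rb} c ≡ toA' b
    canon-inn b with b ≟ from πt (fromℕ (suc (suc m)))
    ... | yes b-last = rt , cong inn (last-letter rowb) , rt≢rb ,
                       trans toA'-rt (sym (trans (cong toA' (trans b-last (last-letter rowt))) toA'-rb))
    ... | no b-not-last = b , refl , (λ b≡rb → b-not-last (trans b≡rb (sym (last-letter rowt)))) , refl

    canon-out : ∀ c → Sym→A' {rt = rt} {rb} (canon π (out c)) ≡ toA' c
    canon-out c with c ≟ from πb zero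
    ... | yes c-L = trans (cong toA' (first-letter rowt))
                      (trans toA'-rt (sym (trans (cong toA' (trans c-L (first-letter rowb))) toA'-rb)))
    ... | no _    = refl

    -- The key identity: σ^out_π(x) = τ_t(τ_b⁻¹(x)) for any cycles written
    -- by the two rows. Both sides go back one letter in the bottom row and
    -- then forward one letter in the top row.
    σout-cycles : ∀ {f : A' rt rb → A' rt rb} → CycleNotation f (Top.enum πt) →
                  (τb : Perm (A' rt rb)) → CycleNotation (to τb) (Bottom.enum πb) →
                  ∀ x → f (from τb x) ≡ σout π rt rb x
    σout-cycles {f} cnt τb cnb x = begin
      f (from τb x)                                     ≡⟨ cong (f ∘ from τb) (sym (Collapse.col-lift topCollapse x)) ⟩
      f (from τb (toA' a))                              ≡⟨ cong f (Bottom.unshift rowb τb cnb a≢rb) ⟩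
      f (toA' b)                                        ≡⟨ cong f (sym c↦b) ⟩
      f (toA' c)                                        ≡⟨ Top.shift rowt cnt c≢rb ⟩
      toA' (from πt (sucMod (to πt c)))                 ≡⟨ sym (canon-out (from πt (sucMod (to πt c)))) ⟩
      Sym→A' (canon π (out (from πt (sucMod (to πt c))))) ≡⟨ cong (Sym→A' ∘ canon π) (sym (σ̃-inn c c-not-last)) ⟩
      Sym→A' (canon π (σ̃ π (inn c)))                   ≡⟨ cong (Sym→A' ∘ canon π ∘ σ̃ π) (sym canon-b) ⟩
      Sym→A' (canon π (σ̃ π (canon π (inn b))))         ≡⟨ cong (Sym→A' ∘ σπ π ∘ canon π) (sym (σ̃-out a a-not-first)) ⟩
      Sym→A' (σπ π (σπ π (out a)))                      ≡⟨ cong (Sym→A' ∘ σπ π ∘ σπ π) (sym (A'→Sym-letter x)) ⟩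
      σout π rt rb x                                    ∎
      where
      open ≡-Reasoning
      a : Fin N
      a = letter rt x
      a≢rb : a ≢ rb
      a≢rb = Collapse.lift-≢ topCollapse x
      a-not-first : to πb a ≢ zero
      a-not-first e = a≢rb (trans (at-position πb e) (first-letter rowb))
      b : Fin N
      b = from πb (predMod (to πb a))
      c : Fin N
      c = proj₁ (canon-inn b)
      canon-b : canon π (inn b) ≡ inn c
      canon-b = proj₁ (proj₂ (canon-inn b))
      c≢rb : c ≢ rb
      c≢rb = proj₁ (proj₂ (proj₂ (canon-inn b)))
      c↦b : toA' c ≡ toA' b
      c↦b = proj₂ (proj₂ (proj₂ (canon-inn b)))
      c-not-last : to πt c ≢ fromℕ (suc (suc m))
      c-not-last e = c≢rb (trans (at-position πt e) (last-letter rowt))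

proposition4p1 :
    (m : ℕ) (rt rb : Fin (suc (suc (suc m)))) → rt ≢ rb →
    (σ : Perm (A' rt rb)) →
    let open Prop41 m rt rb σ in
    ((π : LabeledPerm (suc (suc (suc m)))) → Src π →
       Σ (Perm (A' rt rb)) λ τt → Σ (Perm (A' rt rb)) λ τb →
         Tgt τt τb × Sends π τt τb)
    × ((π : LabeledPerm (suc (suc (suc m)))) → Src π →
         (τt τb τt' τb' : Perm (A' rt rb)) →
         Sends π τt τb → Sends π τt' τb' →
         (∀ x → Inverse.to τt x ≡ Inverse.to τt' x)
         × (∀ x → Inverse.to τb x ≡ Inverse.to τb' x))
    × ((π π' : LabeledPerm (suc (suc (suc m)))) → Src π → Src π' →
         (τt τb : Perm (A' rt rb)) → Sends π τt τb → Sends π' τt τb →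
         (∀ a → Inverse.to (LabeledPerm.πt π) a ≡ Inverse.to (LabeledPerm.πt π') a)
         × (∀ a → Inverse.to (LabeledPerm.πb π) a ≡ Inverse.to (LabeledPerm.πb π') a))
    × ((τt τb : Perm (A' rt rb)) → Tgt τt τb →
         Σ (LabeledPerm (suc (suc (suc m)))) λ π → Src π × Sends π τt τb)
proposition4p1 m rt rb rt≢rb σ = assign , single-valued , injective , surjective
  where
  open Proposition m rt≢rb
  open Prop41 m rt rb σ
  open LabeledPerm

  rows : ∀ π → Src π → Top.Row (πt π) × Bottom.Row (πb π)
  rows π (std , top₀ , bottom₀ , _) = standard⇒rows π std top₀ bottom₀

  assign : ∀ π → Src π → Σ (Perm (A' rt rb)) λ τt → Σ (Perm (A' rt rb)) λ τb →
           Tgt τt τb × Sends π τt τb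
  assign π src@(_ , _ , _ , σout≡σ) =
    Top.cycle rowt , Bottom.cycle rowb ,
    (Top.cycle-isCycle rowt , Bottom.cycle-isCycle rowb ,
     λ x → trans (σout-cycles π rowt rowb (Top.cycle-notation rowt)
                    (Bottom.cycle rowb) (Bottom.cycle-notation rowb) x) (σout≡σ x)) ,
    (Top.cycle-notation rowt , Bottom.cycle-notation rowb)
    where
    rowt : Top.Row (πt π)
    rowt = proj₁ (rows π src)
    rowb : Bottom.Row (πb π)
    rowb = proj₂ (rows π src)

  single-valued : ∀ π → Src π → (τt τb τt' τb' : Perm (A' rt rb)) →
                  Sends π τt τb → Sends π τt' τb' →
                  (∀ x → to τt x ≡ to τt' x) × (∀ x → to τb x ≡ to τb' x)
  single-valued π src τt τb τt' τb' (cnt , cnb) (cnt' , cnb') =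
    cycle-determines (Top.enum-surjective (proj₁ (rows π src))) cnt cnt' ,
    cycle-determines (Bottom.enum-surjective (proj₂ (rows π src))) cnb cnb'

  injective : ∀ π π' → Src π → Src π' → (τt τb : Perm (A' rt rb)) →
              Sends π τt τb → Sends π' τt τb →
              (∀ a → to (πt π) a ≡ to (πt π') a) × (∀ a → to (πb π) a ≡ to (πb π') a)
  injective π π' src src' τt τb (cnt , cnb) (cnt' , cnb') =
    Top.row-rigid (proj₁ (rows π src)) (proj₁ (rows π' src')) cnt cnt' ,
    Bottom.row-rigid (proj₂ (rows π src)) (proj₂ (rows π' src')) cnb cnb'

  surjective : ∀ τt τb → Tgt τt τb → Σ (LabeledPerm (suc (suc (suc m)))) λ π → Src π × Sends π τt τb
  surjective τt τb (cyclet , cycleb , τtτb⁻¹≡σ) =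
    π , (rows⇒standard rowt rowb , first-letter rowt , first-letter rowb , σout≡σ) , (cnt , cnb)
    where
    top : Σ (Fin N ↔ Fin N) λ p → Top.Row p × CycleNotation (to τt) (Top.enum p)
    top = Top.row-of-cycle τt cyclet
    bottom : Σ (Fin N ↔ Fin N) λ p → Bottom.Row p × CycleNotation (to τb) (Bottom.enum p)
    bottom = Bottom.row-of-cycle τb cycleb
    π : LabeledPerm N
    π = record { πt = proj₁ top ; πb = proj₁ bottom }
    rowt : Top.Row (πt π)
    rowt = proj₁ (proj₂ top)
    rowb : Bottom.Row (πb π)
    rowb = proj₁ (proj₂ bottom)
    cnt : CycleNotation (to τt) (Top.enum (πt π))
    cnt = proj₂ (proj₂ top)
    cnb : CycleNotation (to τb) (Bottom.enum (πb π))
    cnb = proj₂ (proj₂ bottom)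
    σout≡σ : ∀ x → σout π rt rb x ≡ to σ x
    σout≡σ x = trans (sym (σout-cycles π rowt rowb cnt τb cnb x)) (τtτb⁻¹≡σ x)
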